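{- Let $C=(I,V,E,O)$ be a CDAG and $S\ge 1$. For any complete calculation of the recompute-restricted red-blue pebble game on $C$ using at most $S$ red pebbles and containing exactly $q$ I/O moves (moves of type R1 or R2), there exists a $2S^{NR}$-partitioning of $C$ into $h$ subsets such that $S\cdot h\ge q\ge S\cdot(h-1)$.
   Context: A CDAG is a 4-tuple $C=(I,V,E,O)$ of finite sets with $E\subseteq V\times V$, $(V,E)$ a directed acyclic graph, $I\subseteq V$ (inputs) consisting of vertices with no incoming edges, and $O\subseteq V$ (outputs); vertices without predecessors need not be inputs and vertices without successors need not be outputs. Recompute-restricted red-blue pebble game: with $S$ red pebbles and arbitrarily many blue pebbles, start with a blue pebble on each vertex of $I$. Moves: R1 place a red pebble on a vertex carrying a blue pebble; R2 place a blue pebble on a vertex carrying a red pebble; R3-NR if all immediate predecessors of $v\in V\setminus I$ carry red pebbles (vacuous if none) and a red pebble has never previously been placed on $v$, place a red pebble on $v$; R4 remove a red pebble from any vertex. At most $S$ red pebbles may be on the graph at any time. A complete calculation is a sequence of moves in which each vertex of $V\setminus I$ is fired exactly once by R3-NR and which ends with blue pebbles on all vertices of $O$. For $T\ge 1$, a $T^{NR}$-partitioning of $C$ is a collection of $h$ subsets $V_1,\dots,V_h$ of $V\setminus I$ such that: (P1) they are pairwise disjoint and their union is $V\setminus I$; (P2) there is no cyclic dependence between the subsets (the graph on $\{V_1,\dots,V_h\}$ with an arc $V_i\to V_j$, $i\ne j$, whenever $E$ contains an edge from $V_i$ to $V_j$, is acyclic); (P3) for all $i$, $|\mathrm{In}(V_i)|\le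 T$; (P4) for all $i$, $|\mathrm{Out}(V_i)|\le T$. Here $\mathrm{In}(V_i)$ is the set of vertices of $V\setminus V_i$ having at least one successor in $V_i$, and $\mathrm{Out}(V_i)$ is the set of vertices of $V_i$ that belong to $O$ or have at least one successor outside $V_i$. A $2S^{NR}$-partitioning is a $T^{NR}$-partitioning with $T=2S$. -}

module Defs where

open import Data.Nat using (ℕ; zero; suc; _+_; _*_; _∸_; _≤_)
open import Data.Bool using (Bool; true; false; not; _∧_; _∨_; if_then_else_)
open import Data.Fin using (Fin)
open import Data.Vec using (Vec; lookup; tabulate; replicate; _[_]≔_)
open import Data.Fin.Subset using (Subset; ∣_∣)
open import Data.List using (List; []; _∷_)
open import Data.Empty using (⊥)
open import Data.Product using (Σ; _×_; ∃; ∃-syntax)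
open import Relation.Nullary using (¬_)
open import Relation.Nullary.Decidable using (⌊_⌋)
import Data.Fin
open import Relation.Binary.PropositionalEquality using (_≡_; _≢_)
open import Relation.Binary.Construct.Closure.Transitive using (TransClosure)

existsB : {m : ℕ} → (Fin m → Bool) → Bool
existsB {zero}  f = false
existsB {suc m} f = f Data.Fin.zero ∨ existsB {m} (λ k → f (Data.Fin.suc k))

Acyclic : {m : ℕ} → (Fin m → Fin m → Set) → Set
Acyclic {m} R = (v : Fin m) → ¬ TransClosure R v v

-- CDAGs.  Vertex set V = Fin n; a subset of V is a Subset n (Vec Bool n),
-- membership of v in P being  lookup P v ≡ true .
-- The edge set E ⊆ V × V is given by its characteristic function.

record CDAG : Set where
  field
    n     : ℕ
    I     : Subset n
    E     : Fin n → Fin n → Bool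
    O     : Subset n
    dag   : Acyclic (λ u v → E u v ≡ true)
    inputs-no-pred : (u v : Fin n) → E u v ≡ true → lookup I v ≡ false

module _ (C : CDAG) where
  open CDAG C

  In : Subset n → Subset n
  In P = tabulate (λ u → not (lookup P u) ∧ existsB (λ v → E u v ∧ lookup P v))

  Out : Subset n → Subset n
  Out P = tabulate (λ u → lookup P u ∧
                          (lookup O u ∨ existsB (λ v → E u v ∧ not (lookup P v))))

  record Partitioning (T : ℕ) (h : ℕ) (Vs : Fin h → Subset n) : Set where
    field
      sub-V∖I  : (i : Fin h) (v : Fin n) → lookup (Vs i) v ≡ true → lookup I v ≡ false
      disjoint : (i j : Fin h) (v : Fin n) → i ≢ j →
                 lookup (Vs i) v ≡ true → lookup (Vs j) v ≡ true → ⊥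
      cover    : (v : Fin n) → lookup I v ≡ false → ∃[ i ] (lookup (Vs i) v ≡ true)
      noCycle  : Acyclic (λ i j → i ≢ j × ∃[ u ] ∃[ v ]
                   (lookup (Vs i) u ≡ true × lookup (Vs j) v ≡ true × E u v ≡ true))
      inBound  : (i : Fin h) → ∣ In (Vs i) ∣ ≤ T
      outBound : (i : Fin h) → ∣ Out (Vs i) ∣ ≤ T

  data Move : Set where
    R1 R2 R3 R4 : Fin n → Move

  record State : Set where
    constructor st
    field
      red    : Subset n
      blue   : Subset n
      placed : Subset n   -- vertices on which a red pebble has ever been placed

  initial : State
  initial = st (replicate n false) I (replicate n false)

  -- One legal move (ignoring the bound on red pebbles)
  data Step : State → Move → State → Set where
    r1 : ∀ {r b p} v → lookup b v ≡ true →
         Step (st r b p) (R1 v) (st (r [ v ]≔ true) b (p [ v ]≔ true))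
    r2 : ∀ {r b p} v → lookup r v ≡ true →
         Step (st r b p) (R2 v) (st r (b [ v ]≔ true) p)
    r3 : ∀ {r b p} v → lookup I v ≡ false →
         ((u : Fin n) → E u v ≡ true → lookup r u ≡ true) →
         lookup p v ≡ false →
         Step (st r b p) (R3 v) (st (r [ v ]≔ true) b (p [ v ]≔ true))
    r4 : ∀ {r b p} v → lookup r v ≡ true →
         Step (st r b p) (R4 v) (st (r [ v ]≔ false) b p)

  data Run (S : ℕ) : State → List Move → State → Set where
    done : ∀ {s} → Run S s [] s
    next : ∀ {s m s' ms s''} → Step s m s' → ∣ State.red s' ∣ ≤ S →
           Run S s' ms s'' → Run S s (m ∷ ms) s''

  isIO : Move → Bool
  isIO (R1 _) = true
  isIO (R2 _) = true
  isIO (R3 _) = false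
  isIO (R4 _) = false

  firesAt : Fin n → Move → Bool
  firesAt v (R3 w) = ⌊ v Data.Fin.≟ w ⌋
  firesAt v _      = false

  countB : (Move → Bool) → List Move → ℕ
  countB f []       = 0
  countB f (m ∷ ms) = if f m then suc (countB f ms) else countB f ms

  ioMoves : List Move → ℕ
  ioMoves = countB isIO

  CompleteCalculation : (S : ℕ) → List Move → Set
  CompleteCalculation S ms =
    Σ State λ final → Run S initial ms final ×
      ((v : Fin n) → lookup I v ≡ false → countB (firesAt v) ms ≡ 1) ×
      ((v : Fin n) → lookup O v ≡ true → lookup (State.blue final) v ≡ true)

module Submission where

-- Cut a complete calculation with q I/O moves
-- into consecutive chunks, every chunk holding at most S I/O moves and every
-- chunk but the last exactly S; with h chunks this gives S·(h-1) ≤ q ≤ S·h.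
-- Let V_i be the set of vertices fired (by R3-NR) during chunk i.  Then
--   * an edge from V_i to V_j with i ≠ j forces i < j: when the target fires,
--     the source is red, hence was already fired in an earlier chunk;
--   * In(V_i) consists of vertices that are red when chunk i starts or are
--     loaded by R1 during it, so |In(V_i)| ≤ S + S;
--   * Out(V_i) consists of vertices that are red when chunk i ends or are
--     stored by R2 during it: any other vertex of V_i is "inert" (placed but
--     without pebbles) from then on, so it never becomes blue again and never
--     feeds a later firing; hence |Out(V_i)| ≤ S + S.

open import Defs
open import Data.Nat using (ℕ; zero; suc; _+_; _*_; _∸_; _≤_; _<_; _≥_; z≤n; s≤s; _≤?_)
open import Data.Nat.Properties
  using (≤-refl; ≤-trans; ≤-reflexive; n≤1+n; m≤n⇒m≤1+n; m≤m+n; m≤n+m; +-mono-≤;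
         +-monoʳ-≤; +-suc; +-comm; +-identityʳ; *-suc; *-zeroʳ; +-cancelʳ-≤; <-irrefl;
         <-trans; module ≤-Reasoning)
open import Data.Bool using (Bool; true; false; not; _∧_; _∨_)
open import Data.Fin using (Fin; toℕ) renaming (zero to fzero; suc to fsuc)
import Data.Fin as Fin
open import Data.Fin.Properties using (<-cmp)
open import Data.Fin.Subset using (Subset; ∣_∣)
open import Data.Fin.Subset.Properties using (∣⊥∣≡0; ∣p∣≤∣x∷p∣)
open import Data.Vec using ([]; _∷_; lookup; tabulate; replicate; _[_]≔_)
open import Data.Vec.Properties
  using (lookup∘update; lookup∘update′; lookup∘tabulate; lookup-replicate)
open import Data.List using (List; []; _∷_; _++_; concat; take; drop; length)
import Data.List as List
open import Data.List.Properties using (++-assoc; take-all)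
open import Data.List.Relation.Unary.All using (All; []; _∷_)
import Data.List.Relation.Unary.All as All
open import Data.List.Membership.Propositional.Properties using (∈-lookup)
open import Data.Product using (Σ; _×_; _,_; ∃-syntax; proj₁; proj₂; map₁; uncurry)
open import Data.Sum using (_⊎_; inj₁; inj₂)
open import Data.Empty using (⊥; ⊥-elim)
open import Relation.Nullary using (¬_; Dec; yes; no; does; contradiction)
open import Relation.Nullary.Decidable using (dec-true)
open import Relation.Binary using (tri<; tri≈; tri>)
open import Relation.Binary.PropositionalEquality
  using (_≡_; _≢_; refl; sym; trans; cong; subst; module ≡-Reasoning)
open import Relation.Binary.Construct.Closure.Transitive using (TransClosure; [_]; _∷_)

_∈ˢ_ _∉ˢ_ : ∀ {m} → Fin m → Subset m → Set
x ∈ˢ p = lookup p x ≡ true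
x ∉ˢ p = lookup p x ≡ false

infix 4 _∈ˢ_ _∉ˢ_

true-or-false : (a : Bool) → a ≡ true ⊎ a ≡ false
true-or-false true  = inj₁ refl
true-or-false false = inj₂ refl

∈∉-absurd : ∀ {a : Bool} → a ≡ true → a ≡ false → ⊥
∈∉-absurd a≡true a≡false = contradiction (trans (sym a≡true) a≡false) λ ()

∈-or-∉ : ∀ {m} (x : Fin m) (p : Subset m) → x ∈ˢ p ⊎ x ∉ˢ p
∈-or-∉ x p = true-or-false (lookup p x)

∧-true : ∀ {a b} → a ∧ b ≡ true → a ≡ true × b ≡ true
∧-true {true} b≡true = refl , b≡true

∨-true : ∀ {a b} → a ∨ b ≡ true → a ≡ true ⊎ b ≡ true
∨-true {true}  _      = inj₁ refl
∨-true {false} b≡true = inj₂ b≡true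

not-true : ∀ {a} → not a ≡ true → a ≡ false
not-true {false} _ = refl

existsB-true : ∀ {m} (f : Fin m → Bool) → existsB f ≡ true → ∃[ k ] f k ≡ true
existsB-true {suc m} f holds with ∨-true {f fzero} holds
... | inj₁ here  = fzero , here
... | inj₂ there = let k , fk = existsB-true (λ k → f (fsuc k)) there in fsuc k , fk

does-true : ∀ {A : Set} (a? : Dec A) → does a? ≡ true → A
does-true (yes a) _ = a

∈-tabulate⁻ : ∀ {m} (f : Fin m → Bool) x → x ∈ˢ tabulate f → f x ≡ true
∈-tabulate⁻ f x x∈ = trans (sym (lookup∘tabulate f x)) x∈

∈-tabulate⁺ : ∀ {m} (f : Fin m → Bool) x → f x ≡ true → x ∈ˢ tabulate f
∈-tabulate⁺ f x fx = trans (lookup∘tabulate f x) fx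

∈-set : ∀ {m} (p : Subset m) (y x : Fin m) → x ∈ˢ p [ y ]≔ true → x ≡ y ⊎ x ∈ˢ p
∈-set p y x x∈ with x Fin.≟ y
... | yes x≡y = inj₁ x≡y
... | no  x≢y = inj₂ (trans (sym (lookup∘update′ x≢y p true)) x∈)

set-here : ∀ {m} (p : Subset m) (y : Fin m) → y ∈ˢ p [ y ]≔ true
set-here p y = lookup∘update y p true

set-keeps : ∀ {m} (p : Subset m) (y : Fin m) {x} → x ∈ˢ p → x ∈ˢ p [ y ]≔ true
set-keeps p y {x} x∈ with x Fin.≟ y
... | yes refl = set-here p x
... | no  x≢y  = trans (lookup∘update′ x≢y p true) x∈

∈-unset : ∀ {m} (p : Subset m) (y x : Fin m) → x ∈ˢ p [ y ]≔ false → x ∈ˢ p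
∈-unset p y x x∈ with x Fin.≟ y
... | yes refl = contradiction (trans (sym x∈) (lookup∘update x p false)) λ ()
... | no  x≢y  = trans (sym (lookup∘update′ x≢y p false)) x∈

∉-empty : ∀ {m} (x : Fin m) → ¬ x ∈ˢ replicate m false
∉-empty x x∈ = ∈∉-absurd x∈ (lookup-replicate x false)

∣set∣≤ : ∀ {m} (p : Subset m) (y : Fin m) → ∣ p [ y ]≔ true ∣ ≤ suc ∣ p ∣
∣set∣≤ (true  ∷ p) fzero    = n≤1+n _
∣set∣≤ (false ∷ p) fzero    = ≤-refl
∣set∣≤ (true  ∷ p) (fsuc y) = s≤s (∣set∣≤ p y)
∣set∣≤ (false ∷ p) (fsuc y) = ∣set∣≤ p y

∣∣≤∣∣+∣∣ : ∀ {m} (p q r : Subset m) → (∀ x → x ∈ˢ p → x ∈ˢ q ⊎ x ∈ˢ r) →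
           ∣ p ∣ ≤ ∣ q ∣ + ∣ r ∣
∣∣≤∣∣+∣∣ [] [] [] _ = z≤n
∣∣≤∣∣+∣∣ (x ∷ p) (y ∷ q) (z ∷ r) cover = head x y z (cover fzero) (∣∣≤∣∣+∣∣ p q r (λ k → cover (fsuc k)))
  where
  head : ∀ x y z → (x ≡ true → y ≡ true ⊎ z ≡ true) → ∣ p ∣ ≤ ∣ q ∣ + ∣ r ∣ →
         ∣ x ∷ p ∣ ≤ ∣ y ∷ q ∣ + ∣ z ∷ r ∣
  head false y     z     _     tail = ≤-trans tail (+-mono-≤ (∣p∣≤∣x∷p∣ y q) (∣p∣≤∣x∷p∣ z r))
  head true  true  z     _     tail = s≤s (≤-trans tail (+-monoʳ-≤ ∣ q ∣ (∣p∣≤∣x∷p∣ z r)))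
  head true  false true  _     tail = subst (suc ∣ p ∣ ≤_) (sym (+-suc ∣ q ∣ ∣ r ∣)) (s≤s tail)
  head true  false false x⇒ _       with x⇒ refl
  ... | inj₁ ()
  ... | inj₂ ()

concat-at : ∀ {A : Set} (xss : List (List A)) (i : Fin (length xss)) →
            concat xss ≡ concat (take (toℕ i) xss) ++ List.lookup xss i
                           ++ concat (drop (suc (toℕ i)) xss)
concat-at (xs ∷ xss) fzero    = refl
concat-at (xs ∷ xss) (fsuc i) = trans (cong (xs ++_) (concat-at xss i)) (sym (++-assoc xs _ _))

positive-+ : ∀ a {b} → 1 ≤ a + b → 1 ≤ a ⊎ 1 ≤ b
positive-+ zero    pos = inj₂ pos
positive-+ (suc a) _   = inj₁ (s≤s z≤n)

module AdditiveMeasure {A : Set} (μ : List A → ℕ)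
  (μ-[] : μ [] ≡ 0) (μ-++ : ∀ xs ys → μ (xs ++ ys) ≡ μ xs + μ ys) where

  chunk≤prefix : ∀ (xss : List (List A)) (k : Fin (length xss)) j → toℕ k < j →
                 μ (List.lookup xss k) ≤ μ (concat (take j xss))
  chunk≤prefix (xs ∷ xss) fzero    (suc j) _ =
    subst (μ xs ≤_) (sym (μ-++ xs _)) (m≤m+n _ _)
  chunk≤prefix (xs ∷ xss) (fsuc k) (suc j) (s≤s k<j) =
    subst (μ (List.lookup xss k) ≤_) (sym (μ-++ xs _))
          (≤-trans (chunk≤prefix xss k j k<j) (m≤n+m _ _))

  prefix-witness : ∀ (xss : List (List A)) j → 1 ≤ μ (concat (take j xss)) →
                   ∃[ k ] toℕ k < j × 1 ≤ μ (List.lookup xss k)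
  prefix-witness xss zero pos = contradiction (subst (1 ≤_) μ-[] pos) λ ()
  prefix-witness [] (suc j) pos = contradiction (subst (1 ≤_) μ-[] pos) λ ()
  prefix-witness (xs ∷ xss) (suc j) pos with positive-+ (μ xs) (subst (1 ≤_) (μ-++ xs _) pos)
  ... | inj₁ here  = fzero , s≤s z≤n , here
  ... | inj₂ later = let k , k<j , pk = prefix-witness xss j later in fsuc k , s≤s k<j , pk

  concat-bound : ∀ {B} (xss : List (List A)) → All (λ xs → μ xs ≤ B) xss →
                 μ (concat xss) ≤ B * length xss
  concat-bound []         []       = ≤-trans (≤-reflexive μ-[]) z≤n
  concat-bound {B} (xs ∷ xss) (b ∷ bs) = begin
    μ (xs ++ concat xss)   ≡⟨ μ-++ xs (concat xss) ⟩
    μ xs + μ (concat xss)  ≤⟨ +-mono-≤ b (concat-bound xss bs) ⟩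
    B + B * length xss     ≡⟨ sym (*-suc B (length xss)) ⟩
    B * suc (length xss)   ∎
    where open ≤-Reasoning

module Pebbling (C : CDAG) where
  open CDAG C
  open State

  countB-++ : ∀ f xs ys → countB C f (xs ++ ys) ≡ countB C f xs + countB C f ys
  countB-++ f []       ys = refl
  countB-++ f (x ∷ xs) ys with f x
  ... | true  = cong suc (countB-++ f xs ys)
  ... | false = countB-++ f xs ys

  countB-∷ : ∀ f m ms → countB C f ms ≤ countB C f (m ∷ ms)
  countB-∷ f m ms with f m
  ... | true  = n≤1+n _
  ... | false = ≤-refl

  countB-mono : ∀ {f g} → (∀ m → f m ≡ true → g m ≡ true) →
                ∀ ms → countB C f ms ≤ countB C g ms
  countB-mono f⇒g []       = z≤n
  countB-mono {f} {g} f⇒g (m ∷ ms) with f m in fm | g m in gm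
  ... | true  | true  = s≤s (countB-mono f⇒g ms)
  ... | true  | false = contradiction (trans (sym (f⇒g m fm)) gm) λ ()
  ... | false | true  = m≤n⇒m≤1+n (countB-mono f⇒g ms)
  ... | false | false = countB-mono f⇒g ms

  fires : Fin n → List (Move C) → ℕ
  fires v = countB C (firesAt C v)

  Fired : Fin n → List (Move C) → Set
  Fired v ms = 1 ≤ fires v ms

  fired-here : ∀ v ms → Fired v (R3 v ∷ ms)
  fired-here v ms with v Fin.≟ v
  ... | yes _  = s≤s z≤n
  ... | no v≢v = contradiction refl v≢v

  fired-there : ∀ {v} m ms → Fired v ms → Fired v (m ∷ ms)
  fired-there {v} m ms f = ≤-trans f (countB-∷ (firesAt C v) m ms)

  fired-∷ : ∀ v m ms → Fired v (m ∷ ms) → m ≡ R3 v ⊎ Fired v ms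
  fired-∷ v (R1 w) ms f = inj₂ f
  fired-∷ v (R2 w) ms f = inj₂ f
  fired-∷ v (R4 w) ms f = inj₂ f
  fired-∷ v (R3 w) ms f with v Fin.≟ w
  ... | yes refl = inj₁ refl
  ... | no  _    = inj₂ f

  isFired : List (Move C) → Fin n → Bool
  isFired ms v = does (1 ≤? fires v ms)

  firedSet : List (Move C) → Subset n
  firedSet ms = tabulate (isFired ms)

  ∈firedSet⁻ : ∀ v ms → v ∈ˢ firedSet ms → Fired v ms
  ∈firedSet⁻ v ms v∈ = does-true (1 ≤? fires v ms) (∈-tabulate⁻ (isFired ms) v v∈)

  ∈firedSet⁺ : ∀ v ms → Fired v ms → v ∈ˢ firedSet ms
  ∈firedSet⁺ v ms f = ∈-tabulate⁺ (isFired ms) v (dec-true (1 ≤? fires v ms) f)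

  target : Move C → Fin n
  target (R1 v) = v
  target (R2 v) = v
  target (R3 v) = v
  target (R4 v) = v

  isR1 isR2 : Move C → Bool
  isR1 (R1 _) = true
  isR1 _      = false
  isR2 (R2 _) = true
  isR2 _      = false

  isR1⇒isIO : ∀ m → isR1 m ≡ true → isIO C m ≡ true
  isR1⇒isIO (R1 _) _ = refl

  isR2⇒isIO : ∀ m → isR2 m ≡ true → isIO C m ≡ true
  isR2⇒isIO (R2 _) _ = refl

  targets : (Move C → Bool) → List (Move C) → Subset n
  targets f []       = replicate n false
  targets f (m ∷ ms) with f m
  ... | true  = targets f ms [ target m ]≔ true
  ... | false = targets f ms

  targets-here : ∀ f m ms → f m ≡ true → target m ∈ˢ targets f (m ∷ ms)
  targets-here f m ms fm with f m
  targets-here f m ms refl | true = set-here (targets f ms) (target m)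

  targets-there : ∀ f m ms {u} → u ∈ˢ targets f ms → u ∈ˢ targets f (m ∷ ms)
  targets-there f m ms u∈ with f m
  ... | true  = set-keeps (targets f ms) (target m) u∈
  ... | false = u∈

  ∣targets∣≤ : ∀ f ms → ∣ targets f ms ∣ ≤ countB C f ms
  ∣targets∣≤ f []       = ≤-reflexive (∣⊥∣≡0 n)
  ∣targets∣≤ f (m ∷ ms) with f m
  ... | true  = ≤-trans (∣set∣≤ (targets f ms) (target m)) (s≤s (∣targets∣≤ f ms))
  ... | false = ∣targets∣≤ f ms

  run-split : ∀ {S s t} xs ys → Run C S s (xs ++ ys) t →
              Σ (State C) λ u → Run C S s xs u × Run C S u ys t
  run-split []       ys r               = _ , done , r
  run-split (x ∷ xs) ys (next step b r) =
    let u , r₁ , r₂ = run-split xs ys r in u , next step b r₁ , r₂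

  red-bound : ∀ {S s ms t} → Run C S s ms t → ∣ red s ∣ ≤ S → ∣ red t ∣ ≤ S
  red-bound done            b = b
  red-bound (next _ b' r) _ = red-bound r b'

  fire-nonInput : ∀ {s v s'} → Step C s (R3 v) s' → lookup I v ≡ false
  fire-nonInput (r3 _ nonInput _ _) = nonInput

  fire-preds : ∀ {s v s'} → Step C s (R3 v) s' → ∀ u → E u v ≡ true → u ∈ˢ red s
  fire-preds (r3 _ _ preds _) = preds

  fire-places : ∀ {s v s'} → Step C s (R3 v) s' → v ∈ˢ placed s'
  fire-places (r3 {p = p} v _ _ _) = set-here p v

  fired-nonInput : ∀ {S s ms t v} → Run C S s ms t → Fired v ms → lookup I v ≡ false
  fired-nonInput {v = v} (next {m = m} {ms = ms} step _ r) f with fired-∷ v m ms f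
  ... | inj₁ refl = fire-nonInput step
  ... | inj₂ f'   = fired-nonInput r f'

  placed-step : ∀ {s m s' u} → Step C s m s' → u ∈ˢ placed s → u ∈ˢ placed s'
  placed-step (r1 {p = p} v _)     = set-keeps p v
  placed-step (r2 _ _)             = λ u∈ → u∈
  placed-step (r3 {p = p} v _ _ _) = set-keeps p v
  placed-step (r4 _ _)             = λ u∈ → u∈

  placed-run : ∀ {S s ms t u} → Run C S s ms t → u ∈ˢ placed s → u ∈ˢ placed t
  placed-run done            u∈ = u∈
  placed-run (next step _ r) u∈ = placed-run r (placed-step step u∈)

  fired-placed : ∀ {S s ms t u} → Run C S s ms t → Fired u ms → u ∈ˢ placed t
  fired-placed {u = u} (next {m = m} {ms = ms} step _ r) f with fired-∷ u m ms f
  ... | inj₁ refl = placed-run r (fire-places step)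
  ... | inj₂ f'   = fired-placed r f'

  record Sane (s : State C) : Set where
    field
      red⇒placed  : ∀ u → u ∈ˢ red s → u ∈ˢ placed s
      blue⇒placed : ∀ u → lookup I u ≡ false → u ∈ˢ blue s → u ∈ˢ placed s
  open Sane

  sane-initial : Sane (initial C)
  sane-initial = record
    { red⇒placed  = λ u u∈ → ⊥-elim (∉-empty u u∈)
    ; blue⇒placed = λ u nonInput u∈ → ⊥-elim (∈∉-absurd u∈ nonInput) }

  mark-red-placed : ∀ (r p : Subset n) v → (∀ u → u ∈ˢ r → u ∈ˢ p) →
                    ∀ u → u ∈ˢ r [ v ]≔ true → u ∈ˢ p [ v ]≔ true
  mark-red-placed r p v r⊆p u u∈ with ∈-set r v u u∈
  ... | inj₁ refl = set-here p u
  ... | inj₂ u∈r  = set-keeps p v (r⊆p u u∈r)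

  sane-step : ∀ {s m s'} → Step C s m s' → Sane s → Sane s'
  sane-step (r1 {r} {p = p} v _) sane = record
    { red⇒placed  = mark-red-placed r p v (red⇒placed sane)
    ; blue⇒placed = λ u nonInput u∈ → set-keeps p v (blue⇒placed sane u nonInput u∈) }
  sane-step (r2 {r} {b} {p} v v∈r) sane = record
    { red⇒placed  = red⇒placed sane
    ; blue⇒placed = blue-placed }
    where
    blue-placed : ∀ u → lookup I u ≡ false → u ∈ˢ b [ v ]≔ true → u ∈ˢ p
    blue-placed u nonInput u∈ with ∈-set b v u u∈
    ... | inj₁ refl = red⇒placed sane u v∈r
    ... | inj₂ u∈b  = blue⇒placed sane u nonInput u∈b
  sane-step (r3 {r} {p = p} v _ _ _) sane = record
    { red⇒placed  = mark-red-placed r p v (red⇒placed sane)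
    ; blue⇒placed = λ u nonInput u∈ → set-keeps p v (blue⇒placed sane u nonInput u∈) }
  sane-step (r4 {r} v _) sane = record
    { red⇒placed  = λ u u∈ → red⇒placed sane u (∈-unset r v u u∈)
    ; blue⇒placed = blue⇒placed sane }

  sane-run : ∀ {S s ms t} → Run C S s ms t → Sane s → Sane t
  sane-run done            sane = sane
  sane-run (next step _ r) sane = sane-run r (sane-step step sane)

  RedSource : State C → List (Move C) → Fin n → Set
  RedSource s ms u = u ∈ˢ red s ⊎ u ∈ˢ targets isR1 ms ⊎ Fired u ms

  red-step : ∀ {s m s' u} → Step C s m s' → u ∈ˢ red s' →
             u ∈ˢ red s ⊎ m ≡ R1 u ⊎ m ≡ R3 u
  red-step {u = u} (r1 {r} v _) u∈ with ∈-set r v u u∈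
  ... | inj₁ refl = inj₂ (inj₁ refl)
  ... | inj₂ u∈r  = inj₁ u∈r
  red-step (r2 v _) u∈ = inj₁ u∈
  red-step {u = u} (r3 {r} v _ _ _) u∈ with ∈-set r v u u∈
  ... | inj₁ refl = inj₂ (inj₂ refl)
  ... | inj₂ u∈r  = inj₁ u∈r
  red-step {u = u} (r4 {r} v _) u∈ = inj₁ (∈-unset r v u u∈)

  red-source-step : ∀ {s m s' ms u} → Step C s m s' → RedSource s' ms u → RedSource s (m ∷ ms) u
  red-source-step {m = m} {ms = ms} step (inj₁ u∈) with red-step step u∈
  ... | inj₁ u∈r         = inj₁ u∈r
  ... | inj₂ (inj₁ refl) = inj₂ (inj₁ (targets-here isR1 m ms refl))
  ... | inj₂ (inj₂ refl) = inj₂ (inj₂ (fired-here _ ms))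
  red-source-step {m = m} {ms = ms} _ (inj₂ (inj₁ loaded)) =
    inj₂ (inj₁ (targets-there isR1 m ms loaded))
  red-source-step {m = m} {ms = ms} _ (inj₂ (inj₂ fired))  =
    inj₂ (inj₂ (fired-there m ms fired))

  predecessor-red : ∀ {S s ms t u v} → Run C S s ms t → Fired v ms → E u v ≡ true →
                    RedSource s ms u
  predecessor-red {u = u} {v} (next {m = m} {ms = ms} step _ r) f e with fired-∷ v m ms f
  ... | inj₁ refl = inj₁ (fire-preds step u e)
  ... | inj₂ f'   = red-source-step {ms = ms} step (predecessor-red r f' e)

  -- Where the placed mark of a non-input u comes from: it was placed at the
  -- start, or it is fired (R1 on a non-input needs it blue, hence placed).
  PlacedSource : State C → List (Move C) → Fin n → Set
  PlacedSource s ms u = u ∈ˢ placed s ⊎ Fired u ms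

  placed-source-step : ∀ {s m s' ms u} → Sane s → lookup I u ≡ false → Step C s m s' →
                       PlacedSource s' ms u → PlacedSource s (m ∷ ms) u
  placed-source-step {m = m} {ms = ms} _ _ _ (inj₂ f) = inj₂ (fired-there m ms f)
  placed-source-step {u = u} sane nonInput (r1 {p = p} v v∈b) (inj₁ u∈) with ∈-set p v u u∈
  ... | inj₁ refl = inj₁ (blue⇒placed sane v nonInput v∈b)
  ... | inj₂ u∈p  = inj₁ u∈p
  placed-source-step _ _ (r2 v _) (inj₁ u∈) = inj₁ u∈
  placed-source-step {ms = ms} {u} _ _ (r3 {p = p} v _ _ _) (inj₁ u∈) with ∈-set p v u u∈
  ... | inj₁ refl = inj₂ (fired-here v ms)
  ... | inj₂ u∈p  = inj₁ u∈p
  placed-source-step _ _ (r4 v _) (inj₁ u∈) = inj₁ u∈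

  placed-history : ∀ {S s ms t u} → Sane s → Run C S s ms t → lookup I u ≡ false →
                   u ∈ˢ placed t → PlacedSource s ms u
  placed-history _    done            _        u∈ = inj₁ u∈
  placed-history sane (next {ms = ms} step _ r) nonInput u∈ =
    placed-source-step {ms = ms} sane nonInput step (placed-history (sane-step step sane) r nonInput u∈)

  predecessor-placed : ∀ {S s ms t u v} → Sane s → Run C S s ms t → Fired v ms →
                       E u v ≡ true → lookup I u ≡ false → PlacedSource s ms u
  predecessor-placed {u = u} {v} sane (next {m = m} {ms = ms} step _ r) f e nonInput
    with fired-∷ v m ms f
  ... | inj₁ refl = inj₁ (red⇒placed sane u (fire-preds step u e))
  ... | inj₂ f'   = placed-source-step {ms = ms} sane nonInput step
                      (predecessor-placed (sane-step step sane) r f' e nonInput)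

  blue-step : ∀ {s m s' u} → Step C s m s' → u ∈ˢ blue s' → u ∈ˢ blue s ⊎ m ≡ R2 u
  blue-step (r1 _ _) u∈ = inj₁ u∈
  blue-step {u = u} (r2 {b = b} v _) u∈ with ∈-set b v u u∈
  ... | inj₁ refl = inj₂ refl
  ... | inj₂ u∈b  = inj₁ u∈b
  blue-step (r3 _ _ _ _) u∈ = inj₁ u∈
  blue-step (r4 _ _) u∈ = inj₁ u∈

  blue-history : ∀ {S s ms t u} → Run C S s ms t → u ∈ˢ blue t →
                 u ∈ˢ blue s ⊎ u ∈ˢ targets isR2 ms
  blue-history done u∈ = inj₁ u∈
  blue-history {ms = m ∷ ms} (next step _ r) u∈ with blue-history r u∈
  ... | inj₂ stored = inj₂ (targets-there isR2 m ms stored)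
  ... | inj₁ u∈b with blue-step step u∈b
  ...   | inj₁ u∈b' = inj₁ u∈b'
  ...   | inj₂ refl = inj₂ (targets-here isR2 m ms refl)

  -- An inert vertex has been placed but carries no pebble.  It stays inert:
  -- R1 needs it blue, R2 needs it red and R3-NR needs it unplaced.
  record Inert (u : Fin n) (s : State C) : Set where
    field
      not-red  : ¬ u ∈ˢ red s
      not-blue : ¬ u ∈ˢ blue s
      is-placed : u ∈ˢ placed s
  open Inert

  inert-step : ∀ {s m s' u} → Step C s m s' → Inert u s → Inert u s'
  inert-step {u = u} step@(r1 {r} v v∈b) inert = record
    { not-red   = no-red
    ; not-blue  = not-blue inert
    ; is-placed = placed-step step (is-placed inert) }
    where
    no-red : ¬ u ∈ˢ r [ v ]≔ true
    no-red u∈ with ∈-set r v u u∈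
    ... | inj₁ refl = not-blue inert v∈b
    ... | inj₂ u∈r  = not-red inert u∈r
  inert-step {u = u} step@(r2 {b = b} v v∈r) inert = record
    { not-red   = not-red inert
    ; not-blue  = no-blue
    ; is-placed = is-placed inert }
    where
    no-blue : ¬ u ∈ˢ b [ v ]≔ true
    no-blue u∈ with ∈-set b v u u∈
    ... | inj₁ refl = not-red inert v∈r
    ... | inj₂ u∈b  = not-blue inert u∈b
  inert-step {u = u} step@(r3 {r} v _ _ v∉p) inert = record
    { not-red   = no-red
    ; not-blue  = not-blue inert
    ; is-placed = placed-step step (is-placed inert) }
    where
    no-red : ¬ u ∈ˢ r [ v ]≔ true
    no-red u∈ with ∈-set r v u u∈
    ... | inj₁ refl = ∈∉-absurd (is-placed inert) v∉p
    ... | inj₂ u∈r  = not-red inert u∈r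
  inert-step {u = u} (r4 {r} v _) inert = record
    { not-red   = λ u∈ → not-red inert (∈-unset r v u u∈)
    ; not-blue  = not-blue inert
    ; is-placed = is-placed inert }

  inert-run : ∀ {S s ms t u} → Run C S s ms t → Inert u s →
              Inert u t × (∀ w → E u w ≡ true → ¬ Fired w ms)
  inert-run done inert = inert , λ w e ()
  inert-run {u = u} (next {m = m} {ms = ms} step _ r) inert =
    let inert' , silent = inert-run r (inert-step step inert) in inert' , no-fire silent
    where
    no-fire : (∀ w → E u w ≡ true → ¬ Fired w ms) →
              ∀ w → E u w ≡ true → ¬ Fired w (m ∷ ms)
    no-fire silent w e f with fired-∷ w m ms f
    ... | inj₁ refl = not-red inert (fire-preds step u e)
    ... | inj₂ f'   = silent w e f'

  ∈In⁻ : ∀ P {u} → u ∈ˢ In C P → u ∉ˢ P × ∃[ v ] E u v ≡ true × v ∈ˢ P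
  ∈In⁻ P {u} u∈ =
    let entry      = λ x → not (lookup P x) ∧ existsB (λ v → E x v ∧ lookup P v)
        u∉P , edge = ∧-true (∈-tabulate⁻ entry u u∈)
        v , e∧v∈P  = existsB-true (λ v → E u v ∧ lookup P v) edge
        e , v∈P    = ∧-true e∧v∈P
    in not-true u∉P , v , e , v∈P

  ∈Out⁻ : ∀ P {u} → u ∈ˢ Out C P →
          u ∈ˢ P × (u ∈ˢ O ⊎ ∃[ w ] E u w ≡ true × w ∉ˢ P)
  ∈Out⁻ P {u} u∈
    with ∧-true (∈-tabulate⁻ (λ x → lookup P x ∧ (lookup O x ∨ existsB (λ v → E x v ∧ not (lookup P v))))
                             u u∈)
  ... | u∈P , reason with ∨-true reason
  ...   | inj₁ output = u∈P , inj₁ output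
  ...   | inj₂ edge   =
    let w , e∧w∉P = existsB-true (λ v → E u v ∧ not (lookup P v)) edge
        e , w∉P   = ∧-true e∧w∉P
    in u∈P , inj₂ (w , e , not-true w∉P)

  module Chunking (f : Move C → Bool) (b : ℕ) where

    count : List (Move C) → ℕ
    count = countB C f

    -- cut k ms: the first chunk ends right after the (suc k)-th f-move of ms
    -- (or at the end of ms); the rest of ms is cut into chunks of suc b.
    cut : ℕ → List (Move C) → List (Move C) × List (List (Move C))
    cut k []       = [] , []
    cut k (m ∷ ms) with f m
    cut k       (m ∷ ms) | false = map₁ (m ∷_) (cut k ms)
    cut zero    (m ∷ ms) | true  = (m ∷ []) , uncurry _∷_ (cut b ms)
    cut (suc k) (m ∷ ms) | true  = map₁ (m ∷_) (cut k ms)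

    cut-concat : ∀ k ms → proj₁ (cut k ms) ++ concat (proj₂ (cut k ms)) ≡ ms
    cut-concat k []       = refl
    cut-concat k (m ∷ ms) with f m
    cut-concat k       (m ∷ ms) | false = cong (m ∷_) (cut-concat k ms)
    cut-concat zero    (m ∷ ms) | true  = cong (m ∷_) (cut-concat b ms)
    cut-concat (suc k) (m ∷ ms) | true  = cong (m ∷_) (cut-concat k ms)

    cut-first : ∀ k ms → count (proj₁ (cut k ms)) ≤ suc k
    cut-first k []       = z≤n
    cut-first k (m ∷ ms) with f m in fm
    cut-first k       (m ∷ ms) | false rewrite fm = cut-first k ms
    cut-first zero    (m ∷ ms) | true  rewrite fm = s≤s z≤n
    cut-first (suc k) (m ∷ ms) | true  rewrite fm = s≤s (cut-first k ms)

    cut-rest : ∀ k ms → All (λ c → count c ≤ suc b) (proj₂ (cut k ms))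
    cut-rest k []       = []
    cut-rest k (m ∷ ms) with f m
    cut-rest k       (m ∷ ms) | false = cut-rest k ms
    cut-rest zero    (m ∷ ms) | true  = cut-first b ms ∷ cut-rest b ms
    cut-rest (suc k) (m ∷ ms) | true  = cut-rest k ms

    -- Every closed chunk used up its whole budget: with the first chunk
    -- allowed suc k moves, the later chunks are paid for by count ms.
    cut-length : ∀ k ms → suc k ≤ suc b →
                 suc b * length (proj₂ (cut k ms)) + suc k ≤ count ms + suc b
    cut-length k [] k<B = subst (λ z → z + suc k ≤ suc b) (sym (*-zeroʳ (suc b))) k<B
    cut-length k (m ∷ ms) k<B with f m
    cut-length k       (m ∷ ms) k<B | false = cut-length k ms k<B
    cut-length zero    (m ∷ ms) _   | true  = close (cut-length b ms ≤-refl)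
      where
      open ≤-Reasoning
      B = suc b
      close : ∀ {L q} → B * L + B ≤ q + B → B * suc L + 1 ≤ suc q + B
      close {L} {q} le = begin
        B * suc L + 1    ≡⟨ +-comm (B * suc L) 1 ⟩
        suc (B * suc L)  ≡⟨ cong suc (*-suc B L) ⟩
        suc (B + B * L)  ≡⟨ cong suc (+-comm B (B * L)) ⟩
        suc (B * L + B)  ≤⟨ s≤s le ⟩
        suc (q + B)      ∎
    cut-length (suc k) (m ∷ ms) k<B | true =
      subst (_≤ suc (count ms + suc b)) (sym (+-suc _ (suc k)))
            (s≤s (cut-length k ms (≤-trans (n≤1+n _) k<B)))

    chunks : List (Move C) → List (List (Move C))
    chunks ms = uncurry _∷_ (cut b ms)

    chunks-concat : ∀ ms → concat (chunks ms) ≡ ms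
    chunks-concat = cut-concat b

    chunks-bounded : ∀ ms → All (λ c → count c ≤ suc b) (chunks ms)
    chunks-bounded ms = cut-first b ms ∷ cut-rest b ms

    chunks-few : ∀ ms → suc b * (length (chunks ms) ∸ 1) ≤ count ms
    chunks-few ms = +-cancelʳ-≤ (suc b) _ _ (cut-length b ms ≤-refl)

  module FiresMeasure (v : Fin n) = AdditiveMeasure (fires v) refl (countB-++ (firesAt C v))
  module IOMeasure = AdditiveMeasure (ioMoves C) refl (countB-++ (isIO C))

  module FromCalculation (b : ℕ) (ms : List (Move C))
                         (calc : CompleteCalculation C (suc b) ms) where

    S : ℕ
    S = suc b

    open Chunking (isIO C) b

    final : State C
    final = proj₁ calc

    run : Run C S (initial C) ms final
    run = proj₁ (proj₂ calc)

    fired-once : ∀ v → lookup I v ≡ false → fires v ms ≡ 1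
    fired-once = proj₁ (proj₂ (proj₂ calc))

    outputs-blue : ∀ v → v ∈ˢ O → v ∈ˢ blue final
    outputs-blue = proj₂ (proj₂ (proj₂ calc))

    h : ℕ
    h = length (chunks ms)

    chunk before after : Fin h → List (Move C)
    chunk  = List.lookup (chunks ms)
    before i = concat (take (toℕ i) (chunks ms))
    after  i = concat (drop (suc (toℕ i)) (chunks ms))

    Vs : Fin h → Subset n
    Vs i = firedSet (chunk i)

    ms-at : ∀ i → ms ≡ before i ++ chunk i ++ after i
    ms-at i = trans (sym (chunks-concat ms)) (concat-at (chunks ms) i)

    record ChunkRun (i : Fin h) : Set where
      field
        start end  : State C
        run-before : Run C S (initial C) (before i) start
        run-chunk  : Run C S start (chunk i) end
        run-after  : Run C S end (after i) final

    chunk-run : ∀ i → ChunkRun i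
    chunk-run i =
      let run-i              = subst (λ xs → Run C S (initial C) xs final) (ms-at i) run
          start , rb , rest  = run-split (before i) (chunk i ++ after i) run-i
          end   , rc , ra    = run-split (chunk i) (after i) rest
      in record { start = start ; end = end ; run-before = rb ; run-chunk = rc ; run-after = ra }

    module _ (i : Fin h) where
      open ChunkRun (chunk-run i) public

      fires-around : ∀ v → fires v ms ≡ fires v (before i) + (fires v (chunk i) + fires v (after i))
      fires-around v = begin
        fires v ms                                          ≡⟨ cong (fires v) (ms-at i) ⟩
        fires v (before i ++ chunk i ++ after i)            ≡⟨ countB-++ _ (before i) _ ⟩
        fires v (before i) + fires v (chunk i ++ after i)   ≡⟨ cong (fires v (before i) +_)
                                                                    (countB-++ _ (chunk i) (after i)) ⟩
        fires v (before i) + (fires v (chunk i) + fires v (after i)) ∎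
        where open ≡-Reasoning

      -- A vertex fired in chunk i was not fired before it: non-inputs fire once.
      not-fired-before : ∀ {v} → Fired v (before i) → ¬ Fired v (chunk i)
      not-fired-before {v} f₁ f₂ = contradiction (≤-trans twice (≤-reflexive once)) λ { (s≤s ()) }
        where
        twice : 2 ≤ fires v ms
        twice = subst (2 ≤_) (sym (fires-around v)) (+-mono-≤ f₁ (≤-trans f₂ (m≤m+n _ _)))
        once : fires v ms ≡ 1
        once = fired-once v (fired-nonInput run (≤-trans (s≤s z≤n) twice))

      fired-where : ∀ {v} → Fired v ms → Fired v (before i) ⊎ Fired v (chunk i) ⊎ Fired v (after i)
      fired-where {v} f with positive-+ (fires v (before i)) (subst (1 ≤_) (fires-around v) f)
      ... | inj₁ early = inj₁ early
      ... | inj₂ later = inj₂ (positive-+ (fires v (chunk i)) later)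

      vertex-nonInput : ∀ {v} → v ∈ˢ Vs i → lookup I v ≡ false
      vertex-nonInput {v} v∈ = fired-nonInput run-chunk (∈firedSet⁻ v (chunk i) v∈)

      sane-start : Sane start
      sane-start = sane-run run-before sane-initial

      placed-at-start : ∀ {u} → lookup I u ≡ false → u ∈ˢ placed start → Fired u (before i)
      placed-at-start {u} nonInput u∈ with placed-history sane-initial run-before nonInput u∈
      ... | inj₁ initially = ⊥-elim (∉-empty u initially)
      ... | inj₂ fired     = fired

      red-at-start : ∣ red start ∣ ≤ S
      red-at-start = red-bound run-before (≤-trans (≤-reflexive (∣⊥∣≡0 n)) z≤n)

      red-at-end : ∣ red end ∣ ≤ S
      red-at-end = red-bound run-chunk red-at-start

      io-targets : ∀ f → (∀ m → f m ≡ true → isIO C m ≡ true) →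
                   ∣ targets f (chunk i) ∣ ≤ S
      io-targets f f⇒io = ≤-trans (∣targets∣≤ f (chunk i))
                                  (≤-trans (countB-mono f⇒io (chunk i))
                                           (All.lookup (chunks-bounded ms) (∈-lookup i)))

    fired-earlier : ∀ {v k l} → Fired v (chunk k) → toℕ k < toℕ l → Fired v (before l)
    fired-earlier {v} {k} fk k<l = ≤-trans fk (FiresMeasure.chunk≤prefix v (chunks ms) k _ k<l)

    same-chunk : ∀ {v} i j → Fired v (chunk i) → Fired v (chunk j) → i ≡ j
    same-chunk {v} i j fi fj with <-cmp i j
    ... | tri< i<j _ _ = ⊥-elim (not-fired-before j (fired-earlier fi i<j) fj)
    ... | tri≈ _ i≡j _ = i≡j
    ... | tri> _ _ j<i = ⊥-elim (not-fired-before i (fired-earlier fj j<i) fi)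

    covered : ∀ v → lookup I v ≡ false → ∃[ i ] v ∈ˢ Vs i
    covered v nonInput =
      let k , _ , fk = FiresMeasure.prefix-witness v (chunks ms) h
                         (subst (Fired v) (sym (trans (cong concat (take-all h (chunks ms) ≤-refl))
                                                      (chunks-concat ms)))
                                (≤-reflexive (sym (fired-once v nonInput))))
      in k , ∈firedSet⁺ v (chunk k) fk

    edge-forward : ∀ {i j u v} → i ≢ j → u ∈ˢ Vs i → v ∈ˢ Vs j → E u v ≡ true →
                   toℕ i < toℕ j
    edge-forward {i} {j} {u} {v} i≢j u∈ v∈ e
      with predecessor-placed (sane-start j) (run-chunk j)
                              (∈firedSet⁻ v (chunk j) v∈) e (vertex-nonInput i u∈)
    ... | inj₂ fired-in-j = ⊥-elim (i≢j (same-chunk i j (∈firedSet⁻ u (chunk i) u∈) fired-in-j))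
    ... | inj₁ placed-at-j =
      let k , k<j , fk = FiresMeasure.prefix-witness u (chunks ms) (toℕ j)
                           (placed-at-start j (vertex-nonInput i u∈) placed-at-j)
      in subst (λ x → toℕ x < toℕ j) (same-chunk k i fk (∈firedSet⁻ u (chunk i) u∈)) k<j

    path-forward : ∀ {i j} → TransClosure (λ i j → i ≢ j × ∃[ u ] ∃[ v ]
                     (u ∈ˢ Vs i × v ∈ˢ Vs j × E u v ≡ true)) i j → toℕ i < toℕ j
    path-forward [ i≢j , _ , _ , u∈ , v∈ , e ]           = edge-forward i≢j u∈ v∈ e
    path-forward ((i≢j , _ , _ , u∈ , v∈ , e) ∷ path) =
      <-trans (edge-forward i≢j u∈ v∈ e) (path-forward path)

    two-S : ∀ {x y} → x ≤ S → y ≤ S → x + y ≤ 2 * S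
    two-S x≤ y≤ = ≤-trans (+-mono-≤ x≤ y≤) (≤-reflexive (cong (S +_) (sym (+-identityʳ S))))

    in-cover : ∀ i x → x ∈ˢ In C (Vs i) → x ∈ˢ red (start i) ⊎ x ∈ˢ targets isR1 (chunk i)
    in-cover i x x∈ with ∈In⁻ (Vs i) x∈
    ... | x∉V , v , e , v∈V with predecessor-red (run-chunk i) (∈firedSet⁻ v (chunk i) v∈V) e
    ...   | inj₁ red-start       = inj₁ red-start
    ...   | inj₂ (inj₁ loaded)   = inj₂ loaded
    ...   | inj₂ (inj₂ fired-in) = ⊥-elim (∈∉-absurd (∈firedSet⁺ x (chunk i) fired-in) x∉V)

    in-bound : ∀ i → ∣ In C (Vs i) ∣ ≤ 2 * S
    in-bound i = ≤-trans (∣∣≤∣∣+∣∣ (In C (Vs i)) (red (start i)) (targets isR1 (chunk i))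
                                   (in-cover i))
                         (two-S (red-at-start i) (io-targets i isR1 isR1⇒isIO))

    inert-after-chunk : ∀ i {x} → x ∈ˢ Vs i → x ∉ˢ red (end i) → x ∉ˢ targets isR2 (chunk i) →
                        Inert x (end i)
    inert-after-chunk i {x} x∈ x∉red x∉stored = record
      { not-red   = λ x∈red → ∈∉-absurd x∈red x∉red
      ; not-blue  = no-blue
      ; is-placed = fired-placed (run-chunk i) (∈firedSet⁻ x (chunk i) x∈) }
      where
      no-blue : ¬ x ∈ˢ blue (end i)
      no-blue x∈blue with blue-history (run-chunk i) x∈blue
      ... | inj₂ stored = ∈∉-absurd stored x∉stored
      ... | inj₁ blue-start =
        not-fired-before i (placed-at-start i (vertex-nonInput i x∈)
                              (blue⇒placed (sane-start i) x (vertex-nonInput i x∈) blue-start))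
                           (∈firedSet⁻ x (chunk i) x∈)

    inert-not-out : ∀ i {x} → Inert x (end i) → ¬ x ∈ˢ Out C (Vs i)
    inert-not-out i {x} inert x∈ with ∈Out⁻ (Vs i) x∈ | inert-run (run-after i) inert
    ... | _   , inj₁ output          | inert-final , _ = not-blue inert-final (outputs-blue x output)
    ... | x∈V , inj₂ (w , e , w∉V) | _ , silent
      with fired-where i (≤-reflexive (sym (fired-once w (inputs-no-pred x w e))))
    ...   | inj₂ (inj₁ in-chunk) = ∈∉-absurd (∈firedSet⁺ w (chunk i) in-chunk) w∉V
    ...   | inj₂ (inj₂ later)    = silent w e later
    ...   | inj₁ earlier
      with predecessor-placed sane-initial (run-before i) earlier e
                              (vertex-nonInput i x∈V)
    ...     | inj₁ initially = ∉-empty x initially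
    ...     | inj₂ x-earlier = not-fired-before i x-earlier (∈firedSet⁻ x (chunk i) x∈V)

    out-cover : ∀ i x → x ∈ˢ Out C (Vs i) → x ∈ˢ red (end i) ⊎ x ∈ˢ targets isR2 (chunk i)
    out-cover i x x∈ with ∈-or-∉ x (red (end i)) | ∈-or-∉ x (targets isR2 (chunk i))
    ... | inj₁ x∈red | _            = inj₁ x∈red
    ... | inj₂ _     | inj₁ stored  = inj₂ stored
    ... | inj₂ x∉red | inj₂ x∉stored =
      let x∈V = proj₁ (∈Out⁻ (Vs i) x∈)
      in ⊥-elim (inert-not-out i (inert-after-chunk i x∈V x∉red x∉stored) x∈)

    out-bound : ∀ i → ∣ Out C (Vs i) ∣ ≤ 2 * S
    out-bound i = ≤-trans (∣∣≤∣∣+∣∣ (Out C (Vs i)) (red (end i)) (targets isR2 (chunk i))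
                                    (out-cover i))
                          (two-S (red-at-end i) (io-targets i isR2 isR2⇒isIO))

    partitioning : Partitioning C (2 * S) h Vs
    partitioning = record
      { sub-V∖I  = λ i v → vertex-nonInput i
      ; disjoint = λ i j v i≢j v∈i v∈j →
                     i≢j (same-chunk i j (∈firedSet⁻ v (chunk i) v∈i) (∈firedSet⁻ v (chunk j) v∈j))
      ; cover    = covered
      ; noCycle  = λ i cycle → <-irrefl refl (path-forward cycle)
      ; inBound  = in-bound
      ; outBound = out-bound }

    io-upper : ioMoves C ms ≤ S * h
    io-upper = subst (λ xs → ioMoves C xs ≤ S * h) (chunks-concat ms)
                     (IOMeasure.concat-bound (chunks ms) (chunks-bounded ms))

    io-lower : S * (h ∸ 1) ≤ ioMoves C ms
    io-lower = chunks-few ms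

theorem3 : (C : CDAG) (S : ℕ) → 1 ≤ S → (ms : List (Move C)) →
           CompleteCalculation C S ms →
           ∃[ h ] Σ (Fin h → Subset (CDAG.n C)) λ Vs →
             Partitioning C (2 * S) h Vs ×
             S * h ≥ ioMoves C ms × ioMoves C ms ≥ S * (h ∸ 1)
theorem3 C (suc b) _ ms calc = h , Vs , partitioning , io-upper , io-lower
  where open Pebbling.FromCalculation C b ms calc
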